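{- For every integer $N\geq 10$ there is $k_0$ such that for all $k\geq k_0$ the following holds. Let $T$ be a graph on $N$ vertices whose vertex set is partitioned as $V(T)=A\cup B$, with $|A|\neq 2$ and $|B|\neq2$, such that if $|A|=4$ then $T[A]$ has no perfect matching and if $|B|=4$ then $T[B]$ has no perfect matching. Then there is an injection $\phi:V(T)\to\mathbb{Z}_2^k$ such that the values $\phi(x)+\phi(y)$, $xy\in E(T)$, are pairwise distinct, and $\sum_{a\in A}\phi(a)=\sum_{b\in B}\phi(b)=0$.
   Context: $T[A]$ denotes the subgraph of $T$ induced on $A$. -}

module Defs where

open import Data.Nat using (ℕ)
open import Data.Bool using (Bool; true; false; _xor_)
open import Data.Fin using (Fin)
open import Data.Fin.Subset using (Subset; _∈_)
open import Data.Vec using (Vec; replicate; zipWith)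
open import Data.List using (foldr; allFin)
open import Data.Product using (Σ; _×_)
open import Relation.Binary.PropositionalEquality using (_≡_)
open import Function.Definitions using (Injective)

record Graph (N : ℕ) : Set where
  field
    adj   : Fin N → Fin N → Bool
    sym   : ∀ x y → adj x y ≡ adj y x
    irrefl : ∀ x → adj x x ≡ false

open Graph public

Edge : ∀ {N} → Graph N → Fin N → Fin N → Set
Edge T x y = adj T x y ≡ true

Z2^ : ℕ → Set
Z2^ k = Vec Bool k

0ᵥ : ∀ {k} → Z2^ k
0ᵥ = replicate _ false

_⊕_ : ∀ {k} → Z2^ k → Z2^ k → Z2^ k
_⊕_ = zipWith _xor_

sumOver : ∀ {N k} → Subset N → (Fin N → Z2^ k) → Z2^ k
sumOver {N} A φ = foldr (λ a acc → (if∈ a) ⊕ acc) 0ᵥ (allFin N)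
  where
  open import Data.Fin.Subset.Properties using (_∈?_)
  open import Relation.Nullary using (yes; no)
  if∈ : Fin N → Z2^ _
  if∈ a with a ∈? A
  ... | yes _ = φ a
  ... | no  _ = 0ᵥ

record PerfectMatching {N} (T : Graph N) (A : Subset N) : Set where
  field
    M        : Fin N → Fin N → Bool
    M-sym    : ∀ x y → M x y ≡ M y x
    M-edge   : ∀ x y → M x y ≡ true → Edge T x y
    M-inA    : ∀ x y → M x y ≡ true → x ∈ A × y ∈ A
    M-cover  : ∀ a → a ∈ A → Σ (Fin N) λ b → M a b ≡ true × (∀ c → M a c ≡ true → c ≡ b)

{-# OPTIONS --safe #-}
module Submission where

-- Identify subsets of V = Fin N with ℤ₂^N and let r(v) be a fixed vertex in the class (A or B) of v.
-- The linear map Λ : ℤ₂^N → ℤ₂^k, k ≥ N, whose coordinates read ξ(v) + ξ(r(v)) (every v read by some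
-- coordinate) has as kernel exactly the unions of classes; put φ(x) = Λ{x}. Then Σ_A φ = Λ A = 0 and
-- Σ_B φ = Λ B = 0. If φ(x) + φ(y) = φ(x′) + φ(y′), the symmetric difference of {x}, {y}, {x′}, {y′}
-- lies in the kernel. Unless {x, y} = {x′, y′} it is nonempty with at most 4 < N elements, hence equal
-- to A or to B, and it has two elements, or four matched by the edges xy and x′y′: both are excluded.

open import Defs
open import Data.Nat using (ℕ; _≤_)
open import Data.Fin using (Fin)
open import Data.Fin.Subset using (Subset; ∁; ∣_∣)
open import Data.Product using (Σ; _×_)
open import Data.Sum using (_⊎_)
open import Relation.Nullary using (¬_)
open import Relation.Binary.PropositionalEquality using (_≡_; _≢_)
open import Function.Definitions using (Injective)

open import Algebra.Bundles using (CommutativeRing)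
import Algebra.Properties.CommutativeSemigroup as CommutativeSemigroupProperties
open import Data.Bool using (Bool; true; false; _xor_; not; if_then_else_)
open import Data.Bool.Properties using (xor-∧-commutativeRing; xor-assoc; xor-comm; xor-same; xor-identityˡ; xor-identityʳ; ¬-not) renaming (_≟_ to _≟ᵇ_)
open import Data.Empty using (⊥-elim)
open import Data.Fin using (zero; suc; inject≤)
open import Data.Fin.Properties using (_≟_; any?)
open import Data.Fin.Subset using (_∈_; _∉_; _∪_; ⁅_⁆; inside; outside)
open import Data.Fin.Subset.Properties using (_∈?_; x∈⁅x⁆; x∈⁅y⁆⇒x≡y; ∣⁅x⁆∣≡1; x∈p∪q⁺; x∈p∪q⁻)
open import Data.List using (List; foldr; allFin)
import Data.List as List
open import Data.List.Properties using (foldr-cong; foldr-fusion; foldr-map; map-tabulate)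
open import Data.Nat using (suc; _+_; _<_; s≤s)
open import Data.Nat.Properties using (+-suc; ≤-trans; m≤m+n)
open import Data.Product using (_,_; proj₁; proj₂; ∃)
import Data.Product as Product
open import Data.Sum using (inj₁; inj₂; [_,_])
import Data.Sum as Sum
open import Data.Vec using (Vec; []; _∷_; here; there; lookup; tabulate)
open import Data.Vec.Properties using (lookup-zipWith; lookup-replicate; lookup-map; lookup∘tabulate; tabulate∘lookup; tabulate-cong; zipWith-assoc; zipWith-comm; zipWith-identityˡ; []=⇒lookup; lookup⇒[]=)
open import Function using (id; _∘_; mk⇔)
open import Relation.Nullary using (Dec; yes; no; does; contradiction)
open import Relation.Nullary.Decidable using (dec-true; does-⇔; _×-dec_; _⊎-dec_)
import Relation.Binary.PropositionalEquality as Eq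
open Eq using (refl; trans; cong; cong₂; subst; module ≡-Reasoning)

private
  variable
    X : Set
    m n k : ℕ

xor-interchange : ∀ a b c d → (a xor b) xor (c xor d) ≡ (a xor c) xor (b xor d)
xor-interchange = CommutativeSemigroupProperties.interchange
  (CommutativeRing.+-commutativeSemigroup xor-∧-commutativeRing)

xor≡false⇒≡ : ∀ {a b} → a xor b ≡ false → a ≡ b
xor≡false⇒≡ {false} {false} _ = refl
xor≡false⇒≡ {true}  {true}  _ = refl

does≡true⇒ : ∀ {P : Set} (P? : Dec P) → does P? ≡ true → P
does≡true⇒ (yes p) _ = p

lookup-ext : {u w : Vec X n} → (∀ i → lookup u i ≡ lookup w i) → u ≡ w
lookup-ext {u = u} {w} u≗w = begin
  u                  ≡⟨ Eq.sym (tabulate∘lookup u) ⟩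
  tabulate (lookup u) ≡⟨ tabulate-cong u≗w ⟩
  tabulate (lookup w) ≡⟨ tabulate∘lookup w ⟩
  w                  ∎
  where open ≡-Reasoning

-- The group ℤ₂^k

lookup-⊕ : (u w : Z2^ k) (i : Fin k) → lookup (u ⊕ w) i ≡ lookup u i xor lookup w i
lookup-⊕ u w i = lookup-zipWith _xor_ i u w

lookup-0ᵥ : (i : Fin k) → lookup (0ᵥ {k}) i ≡ false
lookup-0ᵥ i = lookup-replicate i false

⊕-assoc : (u v w : Z2^ k) → (u ⊕ v) ⊕ w ≡ u ⊕ (v ⊕ w)
⊕-assoc = zipWith-assoc xor-assoc

⊕-comm : (u w : Z2^ k) → u ⊕ w ≡ w ⊕ u
⊕-comm = zipWith-comm xor-comm

⊕-identityˡ : (u : Z2^ k) → 0ᵥ ⊕ u ≡ u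
⊕-identityˡ = zipWith-identityˡ xor-identityˡ

⊕-self : (u : Z2^ k) → u ⊕ u ≡ 0ᵥ
⊕-self []      = refl
⊕-self (a ∷ u) = cong₂ _∷_ (xor-same a) (⊕-self u)

≡⇒⊕≡0ᵥ : {u w : Z2^ k} → u ≡ w → u ⊕ w ≡ 0ᵥ
≡⇒⊕≡0ᵥ refl = ⊕-self _

⊕-involutiveˡ : (u w : Z2^ k) → u ⊕ (u ⊕ w) ≡ w
⊕-involutiveˡ u w = begin
  u ⊕ (u ⊕ w) ≡⟨ Eq.sym (⊕-assoc u u w) ⟩
  (u ⊕ u) ⊕ w ≡⟨ cong (_⊕ w) (⊕-self u) ⟩
  0ᵥ ⊕ w      ≡⟨ ⊕-identityˡ w ⟩
  w           ∎
  where open ≡-Reasoning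

⊕-cancelˡ : (u : Z2^ k) {v w : Z2^ k} → u ⊕ v ≡ u ⊕ w → v ≡ w
⊕-cancelˡ u {v} {w} eq =
  trans (Eq.sym (⊕-involutiveˡ u v)) (trans (cong (u ⊕_) eq) (⊕-involutiveˡ u w))

⊕-cancelʳ : (u : Z2^ k) {v w : Z2^ k} → v ⊕ u ≡ w ⊕ u → v ≡ w
⊕-cancelʳ u {v} {w} eq = ⊕-cancelˡ u (trans (⊕-comm u v) (trans eq (⊕-comm w u)))

-- Sums over a subset

select : Subset n → (Fin n → Z2^ k) → Fin n → Z2^ k
select C ψ a = if lookup C a then ψ a else 0ᵥ

⨁ : (Fin n → Z2^ k) → List (Fin n) → Z2^ k
⨁ f = foldr (λ a → f a ⊕_) 0ᵥ

mutual
  sumOver-select : (C : Subset n) (ψ : Fin n → Z2^ k) → sumOver C ψ ≡ ⨁ (select C ψ) (allFin n)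
  sumOver-select {n} C ψ = foldr-cong (λ a acc → cong (_⊕ acc) (summand-select C ψ a)) refl (allFin n)

  -- The summand of sumOver is local to Defs, so its name is left to unification.
  summand-select : (C : Subset n) (ψ : Fin n → Z2^ k) (a : Fin n) → _ ≡ select C ψ a
  summand-select C ψ a with a ∈? C
  ... | yes a∈C rewrite []=⇒lookup a∈C                  = refl
  ... | no  a∉C rewrite ¬-not (a∉C ∘ lookup⇒[]= a C) = refl

⨁-homo : (f : Z2^ k → Z2^ m) → f 0ᵥ ≡ 0ᵥ → (∀ u w → f (u ⊕ w) ≡ f u ⊕ f w) →
         (g : Fin n → Z2^ k) (xs : List (Fin n)) → f (⨁ g xs) ≡ ⨁ (f ∘ g) xs
⨁-homo f f0 f⊕ g xs =
  trans (foldr-fusion f 0ᵥ (λ a acc → f⊕ (g a) acc) xs) (foldr-cong (λ _ _ → refl) f0 xs)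

sumOver-homo : (f : Z2^ k → Z2^ m) → f 0ᵥ ≡ 0ᵥ → (∀ u w → f (u ⊕ w) ≡ f u ⊕ f w) →
               (C : Subset n) (ψ : Fin n → Z2^ k) → sumOver C (f ∘ ψ) ≡ f (sumOver C ψ)
sumOver-homo {n = n} f f0 f⊕ C ψ = begin
  sumOver C (f ∘ ψ)                 ≡⟨ sumOver-select C (f ∘ ψ) ⟩
  ⨁ (select C (f ∘ ψ)) (allFin n)   ≡⟨ foldr-cong (λ a acc → cong (_⊕ acc) (select-homo a)) refl (allFin n) ⟩
  ⨁ (f ∘ select C ψ) (allFin n)     ≡⟨ Eq.sym (⨁-homo f f0 f⊕ (select C ψ) (allFin n)) ⟩
  f (⨁ (select C ψ) (allFin n))     ≡⟨ cong f (Eq.sym (sumOver-select C ψ)) ⟩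
  f (sumOver C ψ)                   ∎
  where
  open ≡-Reasoning
  select-homo : ∀ a → select C (f ∘ ψ) a ≡ f (select C ψ a)
  select-homo a with lookup C a
  ... | true  = refl
  ... | false = Eq.sym f0

⨁-select-⁅⁆ : (C : Subset n) → ⨁ (select C ⁅_⁆) (allFin n) ≡ C
⨁-select-⁅⁆ []          = refl
⨁-select-⁅⁆ {suc n} (b ∷ C) = begin
  select (b ∷ C) ⁅_⁆ zero ⊕ ⨁ (select (b ∷ C) ⁅_⁆) (List.tabulate suc)
    ≡⟨ cong₂ _⊕_ (select-zero b) shift ⟩
  (b ∷ 0ᵥ) ⊕ (false ∷ ⨁ (select C ⁅_⁆) (allFin n))
    ≡⟨ cong₂ _∷_ (xor-identityʳ b) (trans (⊕-identityˡ _) (⨁-select-⁅⁆ C)) ⟩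
  b ∷ C ∎
  where
  open ≡-Reasoning
  select-zero : ∀ b → select (b ∷ C) ⁅_⁆ zero ≡ b ∷ 0ᵥ
  select-zero true  = refl
  select-zero false = refl
  select-suc : ∀ a → select (b ∷ C) ⁅_⁆ (suc a) ≡ false ∷ select C ⁅_⁆ a
  select-suc a with lookup C a
  ... | true  = refl
  ... | false = refl
  shift : ⨁ (select (b ∷ C) ⁅_⁆) (List.tabulate suc) ≡ false ∷ ⨁ (select C ⁅_⁆) (allFin n)
  shift = begin
    ⨁ (select (b ∷ C) ⁅_⁆) (List.tabulate suc)          ≡⟨ cong (⨁ (select (b ∷ C) ⁅_⁆)) (Eq.sym (map-tabulate id suc)) ⟩
    ⨁ (select (b ∷ C) ⁅_⁆) (List.map suc (allFin n))     ≡⟨ foldr-map _ suc 0ᵥ (allFin n) ⟩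
    ⨁ (select (b ∷ C) ⁅_⁆ ∘ suc) (allFin n)              ≡⟨ foldr-cong (λ a acc → cong (_⊕ acc) (select-suc a)) refl (allFin n) ⟩
    ⨁ ((false ∷_) ∘ select C ⁅_⁆) (allFin n)             ≡⟨ Eq.sym (⨁-homo (false ∷_) refl (λ _ _ → refl) (select C ⁅_⁆) (allFin n)) ⟩
    false ∷ ⨁ (select C ⁅_⁆) (allFin n)                  ∎

sumOver-⁅⁆ : (C : Subset n) → sumOver C ⁅_⁆ ≡ C
sumOver-⁅⁆ C = trans (sumOver-select C ⁅_⁆) (⨁-select-⁅⁆ C)

-- Subsets and the classes of a partition

Disjoint : Subset n → Subset n → Set
Disjoint p q = ∀ {v} → v ∈ p → v ∉ q

Disjoint-tail : ∀ {a b} {p q : Subset n} → Disjoint (a ∷ p) (b ∷ q) → Disjoint p q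
Disjoint-tail disj v∈p v∈q = disj (there v∈p) (there v∈q)

p⊕q≡p∪q : (p q : Subset n) → Disjoint p q → p ⊕ q ≡ p ∪ q
p⊕q≡p∪q []            []            _    = refl
p⊕q≡p∪q (inside  ∷ p) (inside  ∷ q) disj = contradiction here (disj here)
p⊕q≡p∪q (inside  ∷ p) (outside ∷ q) disj = cong (inside ∷_)  (p⊕q≡p∪q p q (Disjoint-tail disj))
p⊕q≡p∪q (outside ∷ p) (inside  ∷ q) disj = cong (inside ∷_)  (p⊕q≡p∪q p q (Disjoint-tail disj))
p⊕q≡p∪q (outside ∷ p) (outside ∷ q) disj = cong (outside ∷_) (p⊕q≡p∪q p q (Disjoint-tail disj))

∣p∪q∣≡∣p∣+∣q∣ : (p q : Subset n) → Disjoint p q → ∣ p ∪ q ∣ ≡ ∣ p ∣ + ∣ q ∣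
∣p∪q∣≡∣p∣+∣q∣ []            []            _    = refl
∣p∪q∣≡∣p∣+∣q∣ (inside  ∷ p) (inside  ∷ q) disj = contradiction here (disj here)
∣p∪q∣≡∣p∣+∣q∣ (inside  ∷ p) (outside ∷ q) disj = cong suc (∣p∪q∣≡∣p∣+∣q∣ p q (Disjoint-tail disj))
∣p∪q∣≡∣p∣+∣q∣ (outside ∷ p) (inside  ∷ q) disj =
  trans (cong suc (∣p∪q∣≡∣p∣+∣q∣ p q (Disjoint-tail disj))) (Eq.sym (+-suc ∣ p ∣ ∣ q ∣))
∣p∪q∣≡∣p∣+∣q∣ (outside ∷ p) (outside ∷ q) disj = ∣p∪q∣≡∣p∣+∣q∣ p q (Disjoint-tail disj)

∣p∣<n⇒∃∉ : (p : Subset n) → ∣ p ∣ < n → ∃ λ b → lookup p b ≡ false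
∣p∣<n⇒∃∉ (outside ∷ p) _           = zero , refl
∣p∣<n⇒∃∉ (inside  ∷ p) (s≤s ∣p∣<n) = Product.map suc id (∣p∣<n⇒∃∉ p ∣p∣<n)

pair : Fin n → Fin n → Subset n
pair x y = ⁅ x ⁆ ∪ ⁅ y ⁆

x∈pair : (x y : Fin n) → x ∈ pair x y
x∈pair x y = x∈p∪q⁺ (inj₁ (x∈⁅x⁆ x))

y∈pair : (x y : Fin n) → y ∈ pair x y
y∈pair x y = x∈p∪q⁺ (inj₂ (x∈⁅x⁆ y))

∈pair⁻ : {x y v : Fin n} → v ∈ pair x y → v ≡ x ⊎ v ≡ y
∈pair⁻ {x = x} {y} v∈xy = Sum.map (x∈⁅y⁆⇒x≡y x) (x∈⁅y⁆⇒x≡y y) (x∈p∪q⁻ ⁅ x ⁆ ⁅ y ⁆ v∈xy)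

⁅x⁆-⁅y⁆-disjoint : {x y : Fin n} → x ≢ y → Disjoint ⁅ x ⁆ ⁅ y ⁆
⁅x⁆-⁅y⁆-disjoint {x = x} {y} x≢y v∈x v∈y = x≢y (trans (Eq.sym (x∈⁅y⁆⇒x≡y x v∈x)) (x∈⁅y⁆⇒x≡y y v∈y))

pair-disjoint : {x y x′ y′ : Fin n} → x ≢ x′ → x ≢ y′ → y ≢ x′ → y ≢ y′ →
                Disjoint (pair x y) (pair x′ y′)
pair-disjoint x≢x′ x≢y′ y≢x′ y≢y′ v∈xy v∈x′y′ with ∈pair⁻ v∈xy | ∈pair⁻ v∈x′y′
... | inj₁ v≡x | inj₁ v≡x′ = x≢x′ (trans (Eq.sym v≡x) v≡x′)
... | inj₁ v≡x | inj₂ v≡y′ = x≢y′ (trans (Eq.sym v≡x) v≡y′)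
... | inj₂ v≡y | inj₁ v≡x′ = y≢x′ (trans (Eq.sym v≡y) v≡x′)
... | inj₂ v≡y | inj₂ v≡y′ = y≢y′ (trans (Eq.sym v≡y) v≡y′)

∣pair∣≡2 : {x y : Fin n} → x ≢ y → ∣ pair x y ∣ ≡ 2
∣pair∣≡2 {x = x} {y} x≢y =
  trans (∣p∪q∣≡∣p∣+∣q∣ ⁅ x ⁆ ⁅ y ⁆ (⁅x⁆-⁅y⁆-disjoint x≢y)) (cong₂ _+_ (∣⁅x⁆∣≡1 x) (∣⁅x⁆∣≡1 y))

ClassConstant : Subset n → Subset n → Set
ClassConstant A D = ∀ {v w} → lookup A v ≡ lookup A w → lookup D v ≡ lookup D w

A-classConstant : (A : Subset n) → ClassConstant A A
A-classConstant A Av≡Aw = Av≡Aw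

∁A-classConstant : (A : Subset n) → ClassConstant A (∁ A)
∁A-classConstant A {v} {w} Av≡Aw =
  trans (lookup-map v not A) (trans (cong not Av≡Aw) (Eq.sym (lookup-map w not A)))

classOf : Subset n → Fin n → Subset n
classOf A a = if lookup A a then A else ∁ A

classOf-elim : (P : Subset n → Set) (A : Subset n) → P A → P (∁ A) → ∀ a → P (classOf A a)
classOf-elim P A PA P∁A a with lookup A a
... | true  = PA
... | false = P∁A

lookup-classOf : (A : Subset n) (a v : Fin n) → lookup (classOf A a) v ≡ does (lookup A v ≟ᵇ lookup A a)
lookup-classOf A a v with lookup A a
... | true  = ≡-true (lookup A v)
  where
  ≡-true : ∀ c → c ≡ does (c ≟ᵇ true)
  ≡-true true  = refl
  ≡-true false = refl
... | false = trans (lookup-map v not A) (not-≡-false (lookup A v))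
  where
  not-≡-false : ∀ c → not c ≡ does (c ≟ᵇ false)
  not-≡-false true  = refl
  not-≡-false false = refl

-- Some vertex b lies outside D, so the classes of a and b differ and D is exactly the class of a.
classConstant⇒classOf : (A : Subset n) {D : Subset n} → ClassConstant A D →
                        {a : Fin n} → a ∈ D → ∣ D ∣ < n → D ≡ classOf A a
classConstant⇒classOf A {D} const {a} a∈D small with ∣p∣<n⇒∃∉ D small
... | b , D[b] = lookup-ext pointwise
  where
  D[a] : lookup D a ≡ true
  D[a] = []=⇒lookup a∈D
  A[b]≢A[a] : lookup A b ≢ lookup A a
  A[b]≢A[a] same with trans (Eq.sym D[a]) (trans (Eq.sym (const same)) D[b])
  ... | ()
  member : ∀ v (same? : Dec (lookup A v ≡ lookup A a)) → lookup D v ≡ does same?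
  member v (yes same) = trans (const same) D[a]
  member v (no  diff) = trans (const (trans (¬-not diff) (Eq.sym (¬-not A[b]≢A[a])))) D[b]
  pointwise : ∀ v → lookup D v ≡ lookup (classOf A a) v
  pointwise v = trans (member v (lookup A v ≟ᵇ lookup A a)) (Eq.sym (lookup-classOf A a v))

-- Perfect matchings

module _ (T : Graph n) where

  edge-sym : {x y : Fin n} → Edge T x y → Edge T y x
  edge-sym {x} {y} xy = trans (Graph.sym T y x) xy

  edge⇒≢ : {x y : Fin n} → Edge T x y → x ≢ y
  edge⇒≢ {x} xx refl with trans (Eq.sym xx) (irrefl T x)
  ... | ()

  perfectMatching : {C : Subset n} {R : Fin n → Fin n → Set} (R? : ∀ a b → Dec (R a b)) →
                    (∀ {a b} → R a b → R b a) →
                    (∀ {a b} → R a b → Edge T a b) →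
                    (∀ {a b} → R a b → a ∈ C × b ∈ C) →
                    (∀ {a} → a ∈ C → ∃ λ b → R a b × ∀ {c} → R a c → c ≡ b) →
                    PerfectMatching T C
  perfectMatching {C = C} {R = R} R? R-sym R-edge R-in R-cover = record
    { M       = λ a b → does (R? a b)
    ; M-sym   = λ a b → does-⇔ (mk⇔ R-sym R-sym) (R? a b) (R? b a)
    ; M-edge  = λ a b → R-edge ∘ does≡true⇒ (R? a b)
    ; M-inA   = λ a b → R-in ∘ does≡true⇒ (R? a b)
    ; M-cover = cover
    }
    where
    cover : ∀ a → a ∈ C → Σ (Fin n) λ b → does (R? a b) ≡ true × (∀ c → does (R? a c) ≡ true → c ≡ b)
    cover a a∈C with R-cover a∈C
    ... | b , Rab , unique = b , dec-true (R? a b) Rab , λ c → unique ∘ does≡true⇒ (R? a c)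

  edgeMatching : {x y : Fin n} → Edge T x y → PerfectMatching T (pair x y)
  edgeMatching {x} {y} xy = perfectMatching R? R-sym R-edge R-in R-cover
    where
    R : Fin n → Fin n → Set
    R a b = (a ≡ x × b ≡ y) ⊎ (a ≡ y × b ≡ x)
    R? : ∀ a b → Dec (R a b)
    R? a b = (a ≟ x ×-dec b ≟ y) ⊎-dec (a ≟ y ×-dec b ≟ x)
    R-sym : ∀ {a b} → R a b → R b a
    R-sym = [ inj₂ ∘ Product.swap , inj₁ ∘ Product.swap ]
    R-edge : ∀ {a b} → R a b → Edge T a b
    R-edge (inj₁ (refl , refl)) = xy
    R-edge (inj₂ (refl , refl)) = edge-sym xy
    R-in : ∀ {a b} → R a b → a ∈ pair x y × b ∈ pair x y
    R-in (inj₁ (refl , refl)) = x∈pair x y , y∈pair x y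
    R-in (inj₂ (refl , refl)) = y∈pair x y , x∈pair x y
    R-cover : ∀ {a} → a ∈ pair x y → ∃ λ b → R a b × ∀ {c} → R a c → c ≡ b
    R-cover a∈xy with ∈pair⁻ a∈xy
    ... | inj₁ refl = y , inj₁ (refl , refl) , [ proj₂ , (λ (x≡y , c≡x) → trans c≡x x≡y) ]
    ... | inj₂ refl = x , inj₂ (refl , refl) , [ (λ (y≡x , c≡y) → trans c≡y y≡x) , proj₂ ]

  ∪-matching : {C₁ C₂ : Subset n} → Disjoint C₁ C₂ →
               PerfectMatching T C₁ → PerfectMatching T C₂ → PerfectMatching T (C₁ ∪ C₂)
  ∪-matching {C₁} {C₂} disj m₁ m₂ = perfectMatching R? R-sym R-edge R-in R-cover
    where
    module M₁ = PerfectMatching m₁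
    module M₂ = PerfectMatching m₂
    R : Fin n → Fin n → Set
    R a b = M₁.M a b ≡ true ⊎ M₂.M a b ≡ true
    R? : ∀ a b → Dec (R a b)
    R? a b = (M₁.M a b ≟ᵇ true) ⊎-dec (M₂.M a b ≟ᵇ true)
    R-sym : ∀ {a b} → R a b → R b a
    R-sym {a} {b} = Sum.map (trans (M₁.M-sym b a)) (trans (M₂.M-sym b a))
    R-edge : ∀ {a b} → R a b → Edge T a b
    R-edge {a} {b} = [ M₁.M-edge a b , M₂.M-edge a b ]
    R-in : ∀ {a b} → R a b → a ∈ C₁ ∪ C₂ × b ∈ C₁ ∪ C₂
    R-in {a} {b} = [ Product.map (x∈p∪q⁺ ∘ inj₁) (x∈p∪q⁺ ∘ inj₁) ∘ M₁.M-inA a b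
                   , Product.map (x∈p∪q⁺ ∘ inj₂) (x∈p∪q⁺ ∘ inj₂) ∘ M₂.M-inA a b ]
    R-cover : ∀ {a} → a ∈ C₁ ∪ C₂ → ∃ λ b → R a b × ∀ {c} → R a c → c ≡ b
    R-cover {a} a∈C with x∈p∪q⁻ C₁ C₂ a∈C
    ... | inj₁ a∈C₁ with M₁.M-cover a a∈C₁
    ...   | b , ab , unique =
      b , inj₁ ab , [ unique _ , (λ ac → contradiction (proj₁ (M₂.M-inA a _ ac)) (disj a∈C₁)) ]
    R-cover {a} a∈C | inj₂ a∈C₂ with M₂.M-cover a a∈C₂
    ...   | b , ab , unique =
      b , inj₂ ab , [ (λ ac → contradiction a∈C₂ (disj (proj₁ (M₁.M-inA a _ ac)))) , unique _ ]

-- The encoding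

representative : Subset (suc n) → Bool → Fin (suc n)
representative A c with any? (λ u → lookup A u ≟ᵇ c)
... | yes (u , _) = u
... | no  _       = zero

representative-sameClass : (A : Subset (suc n)) (v : Fin (suc n)) →
                           lookup A (representative A (lookup A v)) ≡ lookup A v
representative-sameClass A v with any? (λ u → lookup A u ≟ᵇ lookup A v)
... | yes (u , A[u]≡A[v]) = A[u]≡A[v]
... | no  none            = contradiction (v , refl) none

clamp : Fin k → Fin (suc n)
clamp             zero    = zero
clamp {n = 0}     (suc j) = zero
clamp {n = suc n} (suc j) = suc (clamp j)

clamp-inject≤ : (v : Fin (suc n)) (le : suc n ≤ k) → clamp (inject≤ v le) ≡ v
clamp-inject≤ {k = suc k}     zero    _        = refl
clamp-inject≤ {suc n} {suc k} (suc v) (s≤s le) = cong suc (clamp-inject≤ v le)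

clamp-onto : suc n ≤ k → (v : Fin (suc n)) → ∃ λ (j : Fin k) → clamp j ≡ v
clamp-onto le v = inject≤ v le , clamp-inject≤ v le

module Encoding (A : Subset (suc n)) (π : Fin k → Fin (suc n)) where

  rep : Fin (suc n) → Fin (suc n)
  rep v = representative A (lookup A v)

  Λ : Subset (suc n) → Z2^ k
  Λ ξ = tabulate λ j → lookup ξ (π j) xor lookup ξ (rep (π j))

  φ : Fin (suc n) → Z2^ k
  φ x = Λ ⁅ x ⁆

  lookup-Λ : (ξ : Subset (suc n)) (j : Fin k) → lookup (Λ ξ) j ≡ lookup ξ (π j) xor lookup ξ (rep (π j))
  lookup-Λ ξ j = lookup∘tabulate _ j

  Λ-⊕ : (ξ ζ : Subset (suc n)) → Λ (ξ ⊕ ζ) ≡ Λ ξ ⊕ Λ ζ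
  Λ-⊕ ξ ζ = lookup-ext pointwise
    where
    open ≡-Reasoning
    pointwise : ∀ j → lookup (Λ (ξ ⊕ ζ)) j ≡ lookup (Λ ξ ⊕ Λ ζ) j
    pointwise j = begin
      lookup (Λ (ξ ⊕ ζ)) j                                        ≡⟨ lookup-Λ (ξ ⊕ ζ) j ⟩
      lookup (ξ ⊕ ζ) v xor lookup (ξ ⊕ ζ) r                       ≡⟨ cong₂ _xor_ (lookup-⊕ ξ ζ v) (lookup-⊕ ξ ζ r) ⟩
      (lookup ξ v xor lookup ζ v) xor (lookup ξ r xor lookup ζ r) ≡⟨ xor-interchange (lookup ξ v) (lookup ζ v) _ _ ⟩
      (lookup ξ v xor lookup ξ r) xor (lookup ζ v xor lookup ζ r) ≡⟨ Eq.sym (cong₂ _xor_ (lookup-Λ ξ j) (lookup-Λ ζ j)) ⟩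
      lookup (Λ ξ) j xor lookup (Λ ζ) j                           ≡⟨ Eq.sym (lookup-⊕ (Λ ξ) (Λ ζ) j) ⟩
      lookup (Λ ξ ⊕ Λ ζ) j                                        ∎
      where
      v r : Fin (suc n)
      v = π j
      r = rep (π j)

  classConstant⇒Λ≡0ᵥ : (ξ : Subset (suc n)) → ClassConstant A ξ → Λ ξ ≡ 0ᵥ
  classConstant⇒Λ≡0ᵥ ξ const = lookup-ext λ j → begin
    lookup (Λ ξ) j                          ≡⟨ lookup-Λ ξ j ⟩
    lookup ξ (π j) xor lookup ξ (rep (π j)) ≡⟨ cong (lookup ξ (π j) xor_) (const (representative-sameClass A (π j))) ⟩
    lookup ξ (π j) xor lookup ξ (π j)       ≡⟨ xor-same (lookup ξ (π j)) ⟩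
    false                                   ≡⟨ Eq.sym (lookup-0ᵥ j) ⟩
    lookup 0ᵥ j                             ∎
    where open ≡-Reasoning

  Λ-0ᵥ : Λ 0ᵥ ≡ 0ᵥ
  Λ-0ᵥ = classConstant⇒Λ≡0ᵥ 0ᵥ λ {v} {w} _ → trans (lookup-0ᵥ v) (Eq.sym (lookup-0ᵥ w))

  Λ≡0ᵥ⇒classConstant : (∀ v → ∃ λ j → π j ≡ v) → (ξ : Subset (suc n)) → Λ ξ ≡ 0ᵥ → ClassConstant A ξ
  Λ≡0ᵥ⇒classConstant onto ξ Λξ≡0ᵥ {v} {w} A[v]≡A[w] = begin
    lookup ξ v       ≡⟨ fixed v ⟩
    lookup ξ (rep v) ≡⟨ cong (lookup ξ ∘ representative A) A[v]≡A[w] ⟩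
    lookup ξ (rep w) ≡⟨ Eq.sym (fixed w) ⟩
    lookup ξ w       ∎
    where
    open ≡-Reasoning
    fixed : ∀ u → lookup ξ u ≡ lookup ξ (rep u)
    fixed u with onto u
    ... | j , refl = xor≡false⇒≡ (trans (Eq.sym (lookup-Λ ξ j))
                                        (trans (cong (λ ζ → lookup ζ j) Λξ≡0ᵥ) (lookup-0ᵥ j)))

  Λ≡Λ⇒classConstant : (∀ v → ∃ λ j → π j ≡ v) → (ξ ζ : Subset (suc n)) → Λ ξ ≡ Λ ζ → ClassConstant A (ξ ⊕ ζ)
  Λ≡Λ⇒classConstant onto ξ ζ Λξ≡Λζ = Λ≡0ᵥ⇒classConstant onto (ξ ⊕ ζ) (trans (Λ-⊕ ξ ζ) (≡⇒⊕≡0ᵥ Λξ≡Λζ))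

  sumOver-φ : (C : Subset (suc n)) → ClassConstant A C → sumOver C φ ≡ 0ᵥ
  sumOver-φ C const = begin
    sumOver C (Λ ∘ ⁅_⁆) ≡⟨ sumOver-homo Λ Λ-0ᵥ Λ-⊕ C ⁅_⁆ ⟩
    Λ (sumOver C ⁅_⁆)   ≡⟨ cong Λ (sumOver-⁅⁆ C) ⟩
    Λ C                 ≡⟨ classConstant⇒Λ≡0ᵥ C const ⟩
    0ᵥ                  ∎
    where open ≡-Reasoning

module Partition (T : Graph (suc n)) (A : Subset (suc n)) (5≤N : 5 ≤ suc n)
                 (∣A∣≢2 : ∣ A ∣ ≢ 2) (∣∁A∣≢2 : ∣ ∁ A ∣ ≢ 2)
                 (no-matching-A : ∣ A ∣ ≡ 4 → ¬ PerfectMatching T A)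
                 (no-matching-∁A : ∣ ∁ A ∣ ≡ 4 → ¬ PerfectMatching T (∁ A))
                 where

  pair-not-classConstant : {x y : Fin (suc n)} → x ≢ y → ¬ ClassConstant A (pair x y)
  pair-not-classConstant {x} {y} x≢y const = classOf-elim (λ C → ∣ C ∣ ≢ 2) A ∣A∣≢2 ∣∁A∣≢2 x (begin
    ∣ classOf A x ∣ ≡⟨ cong ∣_∣ (Eq.sym (classConstant⇒classOf A const (x∈pair x y) 2<N)) ⟩
    ∣ pair x y ∣    ≡⟨ ∣pair∣≡2 x≢y ⟩
    2               ∎)
    where
    open ≡-Reasoning
    2<N : ∣ pair x y ∣ < suc n
    2<N = subst (_< suc n) (Eq.sym (∣pair∣≡2 x≢y)) (≤-trans (m≤m+n 3 2) 5≤N)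

  quad-not-classConstant : {x y x′ y′ : Fin (suc n)} → Edge T x y → Edge T x′ y′ →
                           x ≢ x′ → x ≢ y′ → y ≢ x′ → y ≢ y′ →
                           ¬ ClassConstant A ((⁅ x ⁆ ⊕ ⁅ y ⁆) ⊕ (⁅ x′ ⁆ ⊕ ⁅ y′ ⁆))
  quad-not-classConstant {x} {y} {x′} {y′} xy x′y′ x≢x′ x≢y′ y≢x′ y≢y′ const =
    classOf-elim (λ C → ∣ C ∣ ≡ 4 → ¬ PerfectMatching T C) A no-matching-A no-matching-∁A x
      (trans (cong ∣_∣ (Eq.sym D≡class)) ∣D∣≡4) (subst (PerfectMatching T) D≡class matching)
    where
    D : Subset (suc n)
    D = pair x y ∪ pair x′ y′
    disj : Disjoint (pair x y) (pair x′ y′)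
    disj = pair-disjoint x≢x′ x≢y′ y≢x′ y≢y′
    D-as-⊕ : (⁅ x ⁆ ⊕ ⁅ y ⁆) ⊕ (⁅ x′ ⁆ ⊕ ⁅ y′ ⁆) ≡ D
    D-as-⊕ = trans (cong₂ _⊕_ (p⊕q≡p∪q ⁅ x ⁆ ⁅ y ⁆ (⁅x⁆-⁅y⁆-disjoint (edge⇒≢ T xy)))
                               (p⊕q≡p∪q ⁅ x′ ⁆ ⁅ y′ ⁆ (⁅x⁆-⁅y⁆-disjoint (edge⇒≢ T x′y′))))
                   (p⊕q≡p∪q (pair x y) (pair x′ y′) disj)
    ∣D∣≡4 : ∣ D ∣ ≡ 4
    ∣D∣≡4 = trans (∣p∪q∣≡∣p∣+∣q∣ (pair x y) (pair x′ y′) disj)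
                  (cong₂ _+_ (∣pair∣≡2 (edge⇒≢ T xy)) (∣pair∣≡2 (edge⇒≢ T x′y′)))
    D≡class : D ≡ classOf A x
    D≡class = classConstant⇒classOf A (subst (ClassConstant A) D-as-⊕ const)
                                    (x∈p∪q⁺ (inj₁ (x∈pair x y)))
                                    (subst (_< suc n) (Eq.sym ∣D∣≡4) 5≤N)
    matching : PerfectMatching T D
    matching = ∪-matching T disj (edgeMatching T xy) (edgeMatching T x′y′)

  module Sidon {π : Fin k → Fin (suc n)} (onto : ∀ v → ∃ λ j → π j ≡ v) where

    open Encoding A π public

    φ-injective : Injective _≡_ _≡_ φ
    φ-injective {x} {y} φx≡φy with x ≟ y
    ... | yes x≡y = x≡y
    ... | no  x≢y = ⊥-elim (pair-not-classConstant x≢y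
      (subst (ClassConstant A) (p⊕q≡p∪q ⁅ x ⁆ ⁅ y ⁆ (⁅x⁆-⁅y⁆-disjoint x≢y)) (Λ≡Λ⇒classConstant onto ⁅ x ⁆ ⁅ y ⁆ φx≡φy)))

    φ-sidon : ∀ x y x′ y′ → Edge T x y → Edge T x′ y′ → φ x ⊕ φ y ≡ φ x′ ⊕ φ y′ →
              (x ≡ x′ × y ≡ y′) ⊎ (x ≡ y′ × y ≡ x′)
    φ-sidon x y x′ y′ xy x′y′ eq with x ≟ x′ | x ≟ y′
    ... | yes refl | _        = inj₁ (refl , φ-injective (⊕-cancelˡ (φ x) eq))
    ... | no _     | yes refl = inj₂ (refl , φ-injective (⊕-cancelˡ (φ x) (trans eq (⊕-comm (φ x′) (φ x)))))
    ... | no x≢x′  | no x≢y′ with y ≟ x′ | y ≟ y′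
    ...   | yes refl | _        = contradiction (φ-injective (⊕-cancelʳ (φ y) (trans eq (⊕-comm (φ y) (φ y′))))) x≢y′
    ...   | no _     | yes refl = contradiction (φ-injective (⊕-cancelʳ (φ y) eq)) x≢x′
    ...   | no y≢x′  | no y≢y′  = ⊥-elim (quad-not-classConstant xy x′y′ x≢x′ x≢y′ y≢x′ y≢y′
                                       (Λ≡Λ⇒classConstant onto (⁅ x ⁆ ⊕ ⁅ y ⁆) (⁅ x′ ⁆ ⊕ ⁅ y′ ⁆) Λ-eq))
      where
      Λ-eq : Λ (⁅ x ⁆ ⊕ ⁅ y ⁆) ≡ Λ (⁅ x′ ⁆ ⊕ ⁅ y′ ⁆)
      Λ-eq = trans (Λ-⊕ ⁅ x ⁆ ⁅ y ⁆) (trans eq (Eq.sym (Λ-⊕ ⁅ x′ ⁆ ⁅ y′ ⁆)))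

lemma5p8 : (N : ℕ) → 10 ≤ N →
    Σ ℕ λ k₀ → (k : ℕ) → k₀ ≤ k →
    (T : Graph N) (A : Subset N) →
    ∣ A ∣ ≢ 2 → ∣ ∁ A ∣ ≢ 2 →
    (∣ A ∣ ≡ 4 → ¬ PerfectMatching T A) →
    (∣ ∁ A ∣ ≡ 4 → ¬ PerfectMatching T (∁ A)) →
    Σ (Fin N → Z2^ k) λ φ →
      Injective _≡_ _≡_ φ
      × (∀ x y x′ y′ → Edge T x y → Edge T x′ y′ →
           φ x ⊕ φ y ≡ φ x′ ⊕ φ y′ →
           (x ≡ x′ × y ≡ y′) ⊎ (x ≡ y′ × y ≡ x′))
      × sumOver A φ ≡ 0ᵥ
      × sumOver (∁ A) φ ≡ 0ᵥ
lemma5p8 0       ()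
lemma5p8 (suc n) 10≤N = suc n , λ k N≤k T A ∣A∣≢2 ∣∁A∣≢2 no-matching-A no-matching-∁A →
  let open Partition T A (≤-trans (m≤m+n 5 5) 10≤N) ∣A∣≢2 ∣∁A∣≢2 no-matching-A no-matching-∁A
      open Sidon (clamp-onto N≤k)
  in φ , φ-injective , φ-sidon , sumOver-φ A (A-classConstant A) , sumOver-φ (∁ A) (∁A-classConstant A)
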